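{- Let $G=(A,B,\mathcal{E})$ be a skew-join prime bipartite graph with $B\neq\emptyset$. Let $b_1\in B$ be a vertex of minimum degree in $B$, set $B_1=\{b_1\}$ and $A_1=N(B_1)$. Starting with $i=1$, repeat: (1) let $B_{i+1}=(\overline{N}(A_i)\cap B)\setminus\bigcup_{h=1}^{i}B_h$; if $B_{i+1}=\emptyset$ stop, otherwise (2) let $A_{i+1}=(N(B_{i+1})\cap A)\setminus\bigcup_{h=1}^{i}A_h$, increase $i$ by one and go to (1). If the procedure stops at $i=z$ (i.e. $B_{z+1}=\emptyset$), then $A=\bigcup_{i=1}^z A_i$, $B=\bigcup_{i=1}^z B_i$ is a chain template of $G$.
   Context: For a vertex set $V_1$, $N(V_1)=\bigcup_{v\in V_1}N(v)$ and $\overline{N}(V_1)$ is the set of vertices outside $V_1$ having a non-neighbour in $V_1$. For bipartite graphs $G_1=(A_1,B_1,\mathcal{E}_1)$, $G_2=(A_2,B_2,\mathcal{E}_2)$ the skew-join is $G_1\oslash G_2=(A_1\cup A_2,B_1\cup B_2,\mathcal{E}_1\cup\mathcal{E}_2\cup(A_1\times B_2))$; $G$ is skew-join prime if $G=G_1\oslash G_2$ implies $G_1$ or $G_2$ is empty. $V_1$ is joined (co-joined) to $V_2$ if all (no) edges between them are present. A chain template of $G$ is a partition $A=A_1\cup\dots\cup A_z$, $B=B_1\cup\dots\cup B_z$ with $A_i$ joined to $B_j$ for all $j>i+1$ and $A_i$ co-joined to $B_j$ for all $j<i$. -}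

module Defs where

open import Data.Bool using (Bool; true; false; _∧_; _∨_; not)
open import Data.Nat using (ℕ; zero; suc; _≤_; _<_; _+_)
open import Data.Fin using (Fin)
import Data.Fin as F
open import Data.Vec using (tabulate; lookup)
open import Data.Product using (Σ; _×_; _,_; proj₁; proj₂)
open import Data.Sum using (_⊎_)
open import Relation.Nullary using (¬_)
open import Relation.Binary.PropositionalEquality using (_≡_)
open import Data.Fin.Subset public
  using (Subset; _∈_; _∉_; ⁅_⁆; ∁; _∩_; _∪_; ∣_∣; Empty; Nonempty)
import Data.Fin.Subset as S

-- A bipartite graph G = (A, B, E) with A = Fin m, B = Fin n,
-- and E a = b (Bool-valued) telling whether {a,b} is an edge.
Adj : ℕ → ℕ → Set
Adj m n = Fin m → Fin n → Bool

anyFin : (k : ℕ) → (Fin k → Bool) → Bool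
anyFin zero    f = false
anyFin (suc k) f = f F.zero ∨ anyFin k (λ i → f (F.suc i))

module _ {m n : ℕ} (E : Adj m n) where

  NA : Subset n → Subset m
  NA S = tabulate (λ a → anyFin n (λ b → lookup S b ∧ E a b))

  coNB : Subset m → Subset n
  coNB S = tabulate (λ b → anyFin m (λ a → lookup S a ∧ not (E a b)))

  degB : Fin n → ℕ
  degB b = ∣ NA ⁅ b ⁆ ∣

  -- Skew-join prime: whenever A = A₁ ⊔ A₂, B = B₁ ⊔ B₂ (G₁ on (A₁,B₁),
  -- G₂ on (A₂,B₂)) with G = G₁ ⊘ G₂, i.e. A₁ joined to B₂ and A₂
  -- co-joined to B₁, then G₁ or G₂ is empty (has no vertices).
  SkewJoinPrime : Set
  SkewJoinPrime =
    (A₁ : Subset m) (B₁ : Subset n) →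
    (∀ a b → a ∈ A₁ → b ∉ B₁ → E a b ≡ true) →
    (∀ a b → a ∉ A₁ → b ∈ B₁ → E a b ≡ false) →
    (Empty A₁ × Empty B₁) ⊎ ((∀ a → a ∈ A₁) × (∀ b → b ∈ B₁))

  -- Chain template with parts indexed by 1..z (index families by ℕ).
  ChainTemplate : (z : ℕ) → (ℕ → Subset m) → (ℕ → Subset n) → Set
  ChainTemplate z As Bs =
    (∀ a → Σ ℕ λ i → (1 ≤ i × i ≤ z) × a ∈ As i) ×
    (∀ a i j → 1 ≤ i → i ≤ z → 1 ≤ j → j ≤ z → a ∈ As i → a ∈ As j → i ≡ j) ×
    (∀ b → Σ ℕ λ i → (1 ≤ i × i ≤ z) × b ∈ Bs i) ×
    (∀ b i j → 1 ≤ i → i ≤ z → 1 ≤ j → j ≤ z → b ∈ Bs i → b ∈ Bs j → i ≡ j) ×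
    (∀ i j → 1 ≤ i → j ≤ z → suc i < j → ∀ a b → a ∈ As i → b ∈ Bs j → E a b ≡ true) ×
    (∀ i j → 1 ≤ j → i ≤ z → j < i → ∀ a b → a ∈ As i → b ∈ Bs j → E a b ≡ false)

  -- The procedure started at b₁.  stage k = (A_{k+1}, B_{k+1}, ⋃_{h≤k+1} A_h, ⋃_{h≤k+1} B_h)
  module Procedure (b₁ : Fin n) where
    stage : ℕ → Subset m × Subset n × Subset m × Subset n
    stage zero = NA ⁅ b₁ ⁆ , ⁅ b₁ ⁆ , NA ⁅ b₁ ⁆ , ⁅ b₁ ⁆
    stage (suc k) with stage k
    ... | Ai , Bi , UA , UB =
      let B' = coNB Ai ∩ ∁ UB
          A' = NA B' ∩ ∁ UA
      in A' , B' , UA ∪ A' , UB ∪ B'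

    -- A_i and B_i for i ≥ 1 (index 0 is unused and set to ∅)
    Aseq : ℕ → Subset m
    Aseq zero    = S.⊥
    Aseq (suc k) = proj₁ (stage k)

    Bseq : ℕ → Subset n
    Bseq zero    = S.⊥
    Bseq (suc k) = proj₁ (proj₂ (stage k))

module Submission where

-- Index the stages of the procedure from 0, so that stage k
-- produces the parts A k = A_{k+1}, B k = B_{k+1} and the running unions
-- UA k = A 0 ∪ … ∪ A k, UB k = B 0 ∪ … ∪ B k.  Two closure
-- facts drive everything: every neighbour of B k lies in UA k, and every
-- non-neighbour of A k lies in UB (k+1).  They give directly that A_i is
-- joined to B_j for j > i+1 and co-joined to B_j for j < i.  When the
-- procedure stops (B (z+1) = ∅), the same closure facts say that
-- (UA z, UB z) splits G as a skew-join; since b₁ ∈ UB z, skew-join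
-- primality forces UA z = A and UB z = B, i.e. the parts cover the graph.
-- The main theorem shifts indices back to 1..z and assembles these facts.

open import Defs
open import Data.Nat using (ℕ; suc; _≤_)
open import Data.Fin using (Fin)
open import Data.Nat using (zero; _<_; z≤n; s≤s; _≤′_; ≤′-refl; ≤′-step)
open import Data.Nat.Properties using (≤⇒≤′; <-cmp; n≤1+n; ≤-trans; ≤-refl)
open import Data.Bool using (Bool; true; false; _∧_; not)
open import Data.Product using (Σ; _×_; _,_; proj₁; proj₂)
open import Data.Sum using (inj₁; inj₂)
open import Data.Empty using (⊥-elim)
open import Relation.Binary.PropositionalEquality using (_≡_; refl; sym; trans; subst; cong)
open import Relation.Binary using (tri<; tri≈; tri>)
open import Relation.Nullary using (yes; no)
open import Data.Vec using (tabulate; lookup)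
open import Data.Vec.Properties using ([]=⇒lookup; lookup⇒[]=; lookup∘tabulate)
open import Data.Fin.Subset using (_⊆_)
open import Data.Fin.Subset.Properties
  using (_∈?_; x∈p∩q⁺; x∈p∩q⁻; x∈p∪q⁻; x∈p∪q⁺; x∈∁p⇒x∉p; x∉p⇒x∈∁p; x∈⁅x⁆)
import Data.Fin as F

anyFin-intro : ∀ k (f : Fin k → Bool) i → f i ≡ true → anyFin k f ≡ true
anyFin-intro (suc k) f F.zero    fi rewrite fi = refl
anyFin-intro (suc k) f (F.suc i) fi with f F.zero
... | true  = refl
... | false = anyFin-intro k (λ j → f (F.suc j)) i fi

∈tabulate⁺ : ∀ {d} {f : Fin d → Bool} {x} → f x ≡ true → x ∈ tabulate f
∈tabulate⁺ {f = f} {x} fx = lookup⇒[]= x (tabulate f) (trans (lookup∘tabulate f x) fx)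

module CumulativeParts {d : ℕ} (P U : ℕ → Subset d)
  (base : U zero ≡ P zero)
  (step : ∀ k → U (suc k) ≡ U k ∪ P (suc k))
  (fresh : ∀ k {x} → x ∈ P (suc k) → x ∉ U k) where

  U-step : ∀ k → U k ⊆ U (suc k)
  U-step k x∈ = subst (_ ∈_) (sym (step k)) (x∈p∪q⁺ (inj₁ x∈))

  U-mono : ∀ {k l} → k ≤ l → U k ⊆ U l
  U-mono k≤l = go (≤⇒≤′ k≤l)
    where
    go : ∀ {k l} → k ≤′ l → U k ⊆ U l
    go ≤′-refl        x∈ = x∈
    go (≤′-step k≤′l) x∈ = U-step _ (go k≤′l x∈)

  P⊆U : ∀ k → P k ⊆ U k
  P⊆U zero    x∈ = subst (_ ∈_) (sym base) x∈
  P⊆U (suc k) x∈ = subst (_ ∈_) (sym (step k)) (x∈p∪q⁺ (inj₂ x∈))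

  U-split : ∀ k {x} → x ∈ U k → Σ ℕ λ i → i ≤ k × x ∈ P i
  U-split zero    x∈ = zero , z≤n , subst (_ ∈_) base x∈
  U-split (suc k) x∈ with x∈p∪q⁻ (U k) (P (suc k)) (subst (_ ∈_) (step k) x∈)
  ... | inj₂ x∈P = suc k , ≤-refl , x∈P
  ... | inj₁ x∈U with U-split k x∈U
  ...   | i , i≤k , x∈P = i , ≤-trans i≤k (n≤1+n k) , x∈P

  U-stable : ∀ k → Empty (P (suc k)) → U (suc k) ⊆ U k
  U-stable k empty x∈ with x∈p∪q⁻ (U k) (P (suc k)) (subst (_ ∈_) (step k) x∈)
  ... | inj₁ x∈U = x∈U
  ... | inj₂ x∈P = ⊥-elim (empty (_ , x∈P))

  P-new : ∀ {k l x} → k < l → x ∈ P l → x ∉ U k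
  P-new {k} {suc l} (s≤s k≤l) x∈l x∈k = fresh l x∈l (U-mono k≤l x∈k)

  P-disjoint : ∀ {k l x} → k < l → x ∈ P k → x ∉ P l
  P-disjoint k<l x∈k x∈l = P-new k<l x∈l (P⊆U _ x∈k)

  P-unique : ∀ {i j x} → x ∈ P i → x ∈ P j → i ≡ j
  P-unique {i} {j} x∈i x∈j with <-cmp i j
  ... | tri< i<j _ _ = ⊥-elim (P-disjoint i<j x∈i x∈j)
  ... | tri≈ _ i≡j _ = i≡j
  ... | tri> _ _ j<i = ⊥-elim (P-disjoint j<i x∈j x∈i)

module _ {m n : ℕ} (E : Adj m n) where

  ∈NA⁺ : ∀ S {a b} → b ∈ S → E a b ≡ true → a ∈ NA E S
  ∈NA⁺ S {a} {b} b∈S edge = ∈tabulate⁺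
    (anyFin-intro n (λ b → lookup S b ∧ E a b) b
      (subst (λ t → t ∧ E a b ≡ true) (sym ([]=⇒lookup b∈S)) edge))

  ∈coNB⁺ : ∀ S {a b} → a ∈ S → E a b ≡ false → b ∈ coNB E S
  ∈coNB⁺ S {a} {b} a∈S noEdge = ∈tabulate⁺
    (anyFin-intro m (λ a → lookup S a ∧ not (E a b)) a
      (subst (λ t → t ∧ not (E a b) ≡ true) (sym ([]=⇒lookup a∈S))
        (subst (λ t → true ∧ not t ≡ true) (sym noEdge) refl)))

  module Run (b₁ : Fin n) where
    open Procedure E b₁

    -- Stage k of the procedure, indexed from 0: A k = A_{k+1}, B k = B_{k+1}.
    A : ℕ → Subset m
    A k = proj₁ (stage k)

    B : ℕ → Subset n
    B k = proj₁ (proj₂ (stage k))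

    UA : ℕ → Subset m
    UA k = proj₁ (proj₂ (proj₂ (stage k)))

    UB : ℕ → Subset n
    UB k = proj₂ (proj₂ (proj₂ (stage k)))

    -- Both families of parts are cumulative; freshness is the ∩ ∁ in each step.
    module PA = CumulativeParts A UA refl (λ _ → refl)
      (λ k a∈ → x∈∁p⇒x∉p (proj₂ (x∈p∩q⁻ (NA E (B (suc k))) _ a∈)))
    module PB = CumulativeParts B UB refl (λ _ → refl)
      (λ k b∈ → x∈∁p⇒x∉p (proj₂ (x∈p∩q⁻ (coNB E (A k)) _ b∈)))

    N[B]⊆UA : ∀ k → NA E (B k) ⊆ UA k
    N[B]⊆UA zero    a∈ = a∈
    N[B]⊆UA (suc k) {a} a∈ with a ∈? UA k
    ... | yes a∈U = PA.U-step k a∈U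
    ... | no  a∉U = PA.P⊆U (suc k) (x∈p∩q⁺ (a∈ , x∉p⇒x∈∁p a∉U))

    coN[A]⊆UB : ∀ k → coNB E (A k) ⊆ UB (suc k)
    coN[A]⊆UB k {b} b∈ with b ∈? UB k
    ... | yes b∈U = PB.U-step k b∈U
    ... | no  b∉U = PB.P⊆U (suc k) (x∈p∩q⁺ (b∈ , x∉p⇒x∈∁p b∉U))

    adjacent-outside : ∀ k {a b} → a ∈ A k → b ∉ UB (suc k) → E a b ≡ true
    adjacent-outside k {a} {b} a∈ b∉ with E a b in eq
    ... | true  = refl
    ... | false = ⊥-elim (b∉ (coN[A]⊆UB k (∈coNB⁺ (A k) a∈ eq)))

    nonadjacent-outside : ∀ l {a b} → a ∉ UA l → b ∈ B l → E a b ≡ false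
    nonadjacent-outside l {a} {b} a∉ b∈ with E a b in eq
    ... | false = refl
    ... | true  = ⊥-elim (a∉ (N[B]⊆UA l (∈NA⁺ (B l) b∈ eq)))

    -- A_i is joined to B_j when j > i+1 …
    joined : ∀ {k l a b} → k < l → a ∈ A k → b ∈ B (suc l) → E a b ≡ true
    joined {k} {l} k<l a∈ b∈ =
      adjacent-outside k a∈ (PB.P-new (s≤s k<l) b∈)

    -- … and co-joined to B_j when j < i.
    cojoined : ∀ {k l a b} → l ≤ k → a ∈ A (suc k) → b ∈ B l → E a b ≡ false
    cojoined {k} {l} l≤k a∈ b∈ =
      nonadjacent-outside l (PA.P-new (s≤s l≤k) a∈) b∈

    -- Once the procedure stops, (UA z, UB z) exhibits G as a skew-join.
    stopped-joined : ∀ z → Empty (B (suc z)) →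
      ∀ a b → a ∈ UA z → b ∉ UB z → E a b ≡ true
    stopped-joined z empty a b a∈ b∉ with PA.U-split z a∈
    ... | k , k≤z , a∈k = adjacent-outside k a∈k
          (λ b∈ → b∉ (PB.U-stable z empty (PB.U-mono (s≤s k≤z) b∈)))

    -- (This half holds at every stage.)
    stopped-cojoined : ∀ z →
      ∀ a b → a ∉ UA z → b ∈ UB z → E a b ≡ false
    stopped-cojoined z a b a∉ b∈ with PB.U-split z b∈
    ... | l , l≤z , b∈l = nonadjacent-outside l (λ a∈ → a∉ (PA.U-mono l≤z a∈)) b∈l

    covers : SkewJoinPrime E → ∀ z → Empty (B (suc z)) →
      (∀ a → a ∈ UA z) × (∀ b → b ∈ UB z)
    covers prime z empty
      with prime (UA z) (UB z) (stopped-joined z empty) (stopped-cojoined z)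
    ... | inj₁ (_ , noB) = ⊥-elim (noB (b₁ , PB.U-mono {zero} {z} z≤n (x∈⁅x⁆ b₁)))
    ... | inj₂ full = full

lemma10 : (m n : ℕ) (E : Adj m n) → SkewJoinPrime E →
    (b₁ : Fin n) → (∀ b → degB E b₁ ≤ degB E b) →
    (z : ℕ) → 1 ≤ z →
    (∀ i → 1 ≤ i → i ≤ z → Nonempty (Procedure.Bseq E b₁ i)) →
    Empty (Procedure.Bseq E b₁ (suc z)) →
    ChainTemplate E z (Procedure.Aseq E b₁) (Procedure.Bseq E b₁)
lemma10 m n E prime b₁ _ (suc z) _ _ stop =
  coverA , uniqueA , coverB , uniqueB , joinedAB , cojoinedAB
  where
  open Run E b₁
  open Procedure E b₁ using (Aseq; Bseq)

  full : (∀ a → a ∈ UA z) × (∀ b → b ∈ UB z)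
  full = covers prime z stop

  coverA : ∀ a → Σ ℕ λ i → (1 ≤ i × i ≤ suc z) × a ∈ Aseq i
  coverA a with PA.U-split z (proj₁ full a)
  ... | k , k≤z , a∈k = suc k , (s≤s z≤n , s≤s k≤z) , a∈k

  coverB : ∀ b → Σ ℕ λ i → (1 ≤ i × i ≤ suc z) × b ∈ Bseq i
  coverB b with PB.U-split z (proj₂ full b)
  ... | k , k≤z , b∈k = suc k , (s≤s z≤n , s≤s k≤z) , b∈k

  uniqueA : ∀ a i j → 1 ≤ i → i ≤ suc z → 1 ≤ j → j ≤ suc z → a ∈ Aseq i → a ∈ Aseq j → i ≡ j
  uniqueA a (suc i) (suc j) _ _ _ _ a∈i a∈j = cong suc (PA.P-unique a∈i a∈j)

  uniqueB : ∀ b i j → 1 ≤ i → i ≤ suc z → 1 ≤ j → j ≤ suc z → b ∈ Bseq i → b ∈ Bseq j → i ≡ j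
  uniqueB b (suc i) (suc j) _ _ _ _ b∈i b∈j = cong suc (PB.P-unique b∈i b∈j)

  joinedAB : ∀ i j → 1 ≤ i → j ≤ suc z → suc i < j → ∀ a b → a ∈ Aseq i → b ∈ Bseq j → E a b ≡ true
  joinedAB (suc i) (suc (suc j)) _ _ (s≤s (s≤s i<j)) a b = joined i<j

  cojoinedAB : ∀ i j → 1 ≤ j → i ≤ suc z → j < i → ∀ a b → a ∈ Aseq i → b ∈ Bseq j → E a b ≡ false
  cojoinedAB (suc (suc i)) (suc j) _ _ (s≤s (s≤s j≤i)) a b = cojoined j≤i
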